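{- (a) If $G$ is a pure $(m,C_4)$-special graph with exactly $q$ $C_4$-constituents, then $m=6q-1$, $\iota(G,\mathcal{C}')=q$, and for every $v\in V(G)$ there is a $\mathcal{C}'$-isolating set $D$ of $G$ with $v\in D$ and $|D|=q$. (b) If $G$ is isomorphic to the diamond graph $C_4'$ or to the $5$-cycle $C_5$, then $\iota(G,\mathcal{C}')=1=(|E(G)|+1)/6$, and for every $v\in V(G)$ the set $\{v\}$ is a $\mathcal{C}'$-isolating set of $G$.
   Context: All graphs are finite and simple. For a graph $G$ and $D\subseteq V(G)$, $N[D]$ is the closed neighbourhood of $D$. A set $D\subseteq V(G)$ is a $\mathcal{C}'$-isolating set of $G$ if $G-N[D]$ contains no cycle of length at least $4$ as a subgraph; $\iota(G,\mathcal{C}')$ is the minimum size of such a set. The diamond graph $C_4'$ is the graph on $\{1,2,3,4\}$ with edges $12,23,34,41,13$. $(m,C_4)$-special graphs: let $m\ge 0$ and write $m+1 = 6q + r$ with integers $q\ge 0$, $0\le r\le 5$. If $q=0$, an $(m,C_4)$-special graph is any connected $m$-edge graph (it has no $C_4$-constituents). If $q\ge 1$: take distinct vertices $v_1,\dots,v_q$, and vertex-disjoint $4$-cycles $F_1,\dots,F_q$ (also disjoint from $\{v_1,\dots,v_q\}$); for each $i$ choose $w_i\in V(F_i)$ and let $G_i$ be the graph with vertex set $\{v_i\}\cup V(F_i)$ and edge set $E(F_i)\cup\{v_iw_i\}$. Let $T$ be any tree with vertex set $\{v_1,\dots,v_q\}$, and let $T'$ be any connected graph with exactly $r$ edges such that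 $V(T')\cap\bigcup_{i=1}^q V(G_i)=\{v_q\}$. The graph $G$ with $V(G)=V(T')\cup\bigcup_i V(G_i)$ and $E(G)=E(T)\cup E(T')\cup\bigcup_i E(G_i)$ is an $(m,C_4)$-special graph; the $G_i$ are its $C_4$-constituents, $v_i$ is the $C_4$-connection of $G_i$, and $T'$ is its remainder graph. It is pure if its remainder graph has no edges. -}

module Defs where

open import Data.Nat using (ℕ; zero; suc; _+_; _*_; _≤_; _<ᵇ_)
open import Data.Nat.DivMod using (_%_; m%n<n)
open import Data.Fin using (Fin; toℕ; fromℕ<; zero; suc)
open import Data.Fin.Subset using (Subset; _∈_; _∉_)
open import Data.Bool using (Bool; true; false; _∧_; _∨_; if_then_else_)
open import Data.List using (List; map; allFin)
open import Data.Nat.ListAction using (sum)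
open import Data.Product using (Σ; Σ-syntax; _×_; _,_)
open import Data.Sum using (_⊎_)
open import Data.Unit using (⊤)
open import Relation.Binary.PropositionalEquality using (_≡_; _≢_; refl)
open import Relation.Nullary using (¬_)
open import Function.Definitions using (Injective)

record Graph : Set where
  field
    n          : ℕ
    adj        : Fin n → Fin n → Bool
    adj-sym    : ∀ x y → adj x y ≡ adj y x
    adj-irrefl : ∀ x → adj x x ≡ false
open Graph public

edgeCount : ∀ {n} → (Fin n → Fin n → Bool) → ℕ
edgeCount {n} A =
  sum (map (λ i → sum (map (λ j → if (toℕ i <ᵇ toℕ j) ∧ A i j then 1 else 0)
                           (allFin n)))
           (allFin n))

∣E∣ : Graph → ℕ
∣E∣ G = edgeCount (adj G)

next : ∀ {k} → Fin k → Fin k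
next {suc k} i = fromℕ< (m%n<n (suc (toℕ i)) (suc k))

CycleIn : ∀ {n} → (Fin n → Fin n → Bool) → (Fin n → Set) → ℕ → Set
CycleIn {n} A P k =
  Σ[ f ∈ (Fin k → Fin n) ]
    Injective _≡_ _≡_ f × (∀ i → A (f i) (f (next i)) ≡ true) × (∀ i → P (f i))

InClosedNbhd : (G : Graph) → Subset (n G) → Fin (n G) → Set
InClosedNbhd G D x = x ∈ D ⊎ (Σ[ d ∈ Fin (n G) ] d ∈ D × adj G x d ≡ true)

IsC'Isolating : (G : Graph) → Subset (n G) → Set
IsC'Isolating G D =
  ¬ (Σ[ k ∈ ℕ ] 4 ≤ k × CycleIn (adj G) (λ x → ¬ InClosedNbhd G D x) k)

ι-C'≡ : Graph → ℕ → Set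
ι-C'≡ G k =
  (Σ[ D ∈ Subset (n G) ] IsC'Isolating G D × Data.Fin.Subset.∣ D ∣ ≡ k)
  × (∀ D → IsC'Isolating G D → k ≤ Data.Fin.Subset.∣ D ∣)

data Reach {n} (A : Fin n → Fin n → Bool) : Fin n → Fin n → Set where
  here : ∀ {x} → Reach A x x
  step : ∀ {x y z} → A x y ≡ true → Reach A y z → Reach A x z

IsTree : ∀ {q} → (Fin q → Fin q → Bool) → Set
IsTree {q} T =
  (∀ x y → T x y ≡ T y x) × (∀ x → T x x ≡ false)
  × (∀ x y → Reach T x y)
  × ¬ (Σ[ k ∈ ℕ ] 3 ≤ k × CycleIn T (λ _ → ⊤) k)

-- Up to relabelling of V(G): v i is the C4-connection v_i, the 4-cycle F_i
-- has vertices c i 0, c i 1, c i 2, c i 3 (in cyclic order), w_i = c i (w i),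
-- `last` is the index of v_q, and (R, Radj) is the remainder graph T'.

-- directed generators of E(G) = E(T) ∪ E(T') ∪ ⋃ E(G_i)
SpecialEdge : ∀ {N q} → (Fin q → Fin N) → (Fin q → Fin 4 → Fin N) → (Fin q → Fin 4)
            → (Fin q → Fin q → Bool) → (Fin N → Fin N → Bool) → Fin N → Fin N → Set
SpecialEdge {N} {q} v c w T Radj x y =
  (Σ[ i ∈ Fin q ] Σ[ j ∈ Fin q ] x ≡ v i × y ≡ v j × T i j ≡ true)
  ⊎ (Σ[ i ∈ Fin q ] Σ[ j ∈ Fin 4 ] x ≡ c i j × y ≡ c i (next j))
  ⊎ (Σ[ i ∈ Fin q ] x ≡ v i × y ≡ c i (w i))
  ⊎ Radj x y ≡ true

record Special (m : ℕ) (G : Graph) : Set where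
  field
    q r      : ℕ
    split    : m + 1 ≡ 6 * q + r
    r≤5      : r ≤ 5
    v        : Fin q → Fin (n G)
    v-inj    : Injective _≡_ _≡_ v
    last     : Fin q
    last-is-last : suc (toℕ last) ≡ q
    c        : Fin q → Fin 4 → Fin (n G)
    c-inj    : ∀ i j i′ j′ → c i j ≡ c i′ j′ → i ≡ i′ × j ≡ j′
    v≢c      : ∀ i i′ j → v i ≢ c i′ j
    w        : Fin q → Fin 4
    T        : Fin q → Fin q → Bool
    T-tree   : IsTree T
    R        : Subset (n G)
    Radj     : Fin (n G) → Fin (n G) → Bool
    Radj-sym : ∀ x y → Radj x y ≡ Radj y x
    Radj-irrefl : ∀ x → Radj x x ≡ false
    Radj-in-R   : ∀ x y → Radj x y ≡ true → x ∈ R × y ∈ R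
    R-connected : ∀ x y → x ∈ R → y ∈ R → Reach Radj x y
    R-edges  : edgeCount Radj ≡ r
    vlast∈R  : v last ∈ R
    R-v      : ∀ i → v i ∈ R → i ≡ last
    R-c      : ∀ i j → c i j ∉ R
    cover    : ∀ x → (Σ[ i ∈ Fin q ] x ≡ v i)
                     ⊎ (Σ[ i ∈ Fin q ] Σ[ j ∈ Fin 4 ] x ≡ c i j) ⊎ x ∈ R
    edges→   : ∀ x y → adj G x y ≡ true
                 → SpecialEdge v c w T Radj x y ⊎ SpecialEdge v c w T Radj y x
    edges←   : ∀ x y → SpecialEdge v c w T Radj x y ⊎ SpecialEdge v c w T Radj y x
                 → adj G x y ≡ true

IsPure : ∀ {m G} → Special m G → Set
IsPure S = edgeCount (Special.Radj S) ≡ 0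

record _≅_ (G H : Graph) : Set where
  field
    to       : Fin (n G) → Fin (n H)
    from     : Fin (n H) → Fin (n G)
    from-to  : ∀ x → from (to x) ≡ x
    to-from  : ∀ y → to (from y) ≡ y
    adj-pres : ∀ x y → adj H (to x) (to y) ≡ adj G x y

-- diamond on {1,2,3,4} (here 0..3): edges 12,23,34,41,13
dE : ℕ → ℕ → Bool
dE 0 1 = true
dE 1 2 = true
dE 2 3 = true
dE 3 0 = true
dE 0 2 = true
dE _ _ = false

cE : ℕ → ℕ → Bool
cE 0 1 = true
cE 1 2 = true
cE 2 3 = true
cE 3 4 = true
cE 4 0 = true
cE _ _ = false

symClose : ∀ {k} → (ℕ → ℕ → Bool) → Fin k → Fin k → Bool
symClose E i j = E (toℕ i) (toℕ j) ∨ E (toℕ j) (toℕ i)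

private
  ∨-comm′ : ∀ a b → (a ∨ b) ≡ (b ∨ a)
  ∨-comm′ false false = refl
  ∨-comm′ false true  = refl
  ∨-comm′ true  false = refl
  ∨-comm′ true  true  = refl

  d-irr : ∀ (x : Fin 4) → symClose dE x x ≡ false
  d-irr zero = refl
  d-irr (suc zero) = refl
  d-irr (suc (suc zero)) = refl
  d-irr (suc (suc (suc zero))) = refl

  c-irr : ∀ (x : Fin 5) → symClose cE x x ≡ false
  c-irr zero = refl
  c-irr (suc zero) = refl
  c-irr (suc (suc zero)) = refl
  c-irr (suc (suc (suc zero))) = refl
  c-irr (suc (suc (suc (suc zero)))) = refl

Diamond : Graph
Diamond = record
  { n = 4 ; adj = symClose dE
  ; adj-sym = λ x y → ∨-comm′ (dE (toℕ x) (toℕ y)) (dE (toℕ y) (toℕ x))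
  ; adj-irrefl = d-irr }

C5 : Graph
C5 = record
  { n = 5 ; adj = symClose cE
  ; adj-sym = λ x y → ∨-comm′ (cE (toℕ x) (toℕ y)) (cE (toℕ y) (toℕ x))
  ; adj-irrefl = c-irr }

{-# OPTIONS --safe #-}
module Submission where

-- (a) In a pure special graph the remainder graph is the single vertex v_q, and every edge is a
-- tree edge between connections, an edge of some F_i, or a pendant edge v_i w_i. So once D
-- dominates the tree edges, every path in G − N[D] stays inside one constituent G_i; and G_i has
-- at most three vertices outside N[D] if D contains v_i (the vertices of F_i other than w_i) or a
-- vertex c of F_i (v_i and the vertex of F_i opposite c). Hence four consecutive vertices of a
-- cycle of length ≥ 4 cannot all avoid N[D], which makes {v_1, …, v_q} and each exchange
-- {v_k : k ≠ i} ∪ {c} isolating. Conversely N[D] meets every 4-cycle F_i, and N[V(F_i)] ⊆ V(G_i),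
-- so D meets each of the q disjoint sets V(G_i).
-- (b) In C₄′ and C₅ every vertex has at most two non-neighbours, so each singleton isolates, while
-- the graph is itself a long cycle. Both facts, and the edge count (half the number of ordered
-- adjacent pairs, which a bijection preserves), transfer along isomorphisms.

open import Defs
open import Data.Bool using (Bool; true; false; _∧_; if_then_else_; T)
import Data.Bool as Bool
open import Data.Bool.Properties using (¬-not)
open import Data.Empty using (⊥; ⊥-elim)
open import Data.Fin using (Fin; zero; suc; toℕ; inject₁; punchIn; punchOut; _↑ˡ_; _≟_)
open import Data.Fin.Permutation using (Permutation; permutation; _⟨$⟩ʳ_)
import Data.Fin.Properties as FP
open import Data.Fin.Subset using (Subset; _∈_; ∣_∣; ⁅_⁆; inside; outside; Nonempty)
open import Data.Fin.Subset.Properties using (_∈?_; nonempty?; x∈⁅x⁆; ∣⁅x⁆∣≡1; x∈p⇒∣p-x∣<∣p∣)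
import Data.List as List
import Data.List.Properties as ListP
open import Data.Nat using (ℕ; zero; suc; _+_; _*_; _≤_; _<_; z≤n; s≤s; _<ᵇ_)
open import Data.Nat.ListAction using (sum)
import Data.Nat.Properties as NP
open import Algebra.Properties.CommutativeMonoid.Sum NP.+-0-commutativeMonoid
  using (sum-syntax; ∑-comm; ∑-distrib-+; ∑-permute; sum-cong-≗)
open import Data.Product using (Σ-syntax; _×_; _,_; proj₁; proj₂; map₂; swap)
open import Data.Sum using (_⊎_; inj₁; inj₂)
open import Data.Unit using (⊤; tt)
open import Data.Vec using (_∷_; here; there; tabulate)
import Data.Vec.Properties as VecP
open import Data.Vec.Functional using (updateAt)
open import Data.Vec.Functional.Properties using (updateAt-updates; updateAt-minimal)
open import Function using (id; _∘_; const)
open import Function.Definitions using (Injective)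
open import Relation.Binary.Definitions using (tri<; tri≈; tri>)
open import Relation.Binary.PropositionalEquality
  using (_≡_; _≢_; refl; sym; trans; cong; cong₂; subst; module ≡-Reasoning)
open import Relation.Nullary using (¬_; Dec; yes; no; does)
open import Relation.Nullary.Decidable using (¬?; _→-dec_; _⊎-dec_; _×-dec_; toWitness; dec-true)
open import Relation.Nullary.Negation using (contradiction)

private
  variable
    k M N : ℕ

-- Counting subsets

injective⊆image⇒≤ : ∀ {A : Set} (e : Fin M → A) → Injective _≡_ _≡_ e → (o : Fin k → A) →
                    (∀ a → Σ[ t ∈ Fin k ] e a ≡ o t) → M ≤ k
injective⊆image⇒≤ e e-inj o covered = FP.injective⇒≤ {f = λ a → proj₁ (covered a)} λ {a} {b} t≡t →
  e-inj (trans (proj₂ (covered a)) (trans (cong o t≡t) (sym (proj₂ (covered b)))))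

position : (D : Subset N) {x : Fin N} → x ∈ D → Fin ∣ D ∣
position (inside ∷ D) here = zero
position (inside ∷ D) (there x∈D) = suc (position D x∈D)
position (outside ∷ D) (there x∈D) = position D x∈D

position-injective : (D : Subset N) {x y : Fin N} (x∈D : x ∈ D) (y∈D : y ∈ D) →
                     position D x∈D ≡ position D y∈D → x ≡ y
position-injective (inside ∷ D) here here _ = refl
position-injective (inside ∷ D) (there x∈D) (there y∈D) p≡p =
  cong suc (position-injective D x∈D y∈D (FP.suc-injective p≡p))
position-injective (outside ∷ D) (there x∈D) (there y∈D) p≡p =
  cong suc (position-injective D x∈D y∈D p≡p)

element : (D : Subset N) → Fin ∣ D ∣ → Fin N
element (inside ∷ D) zero = zero
element (inside ∷ D) (suc a) = suc (element D a)
element (outside ∷ D) a = suc (element D a)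

element∈ : (D : Subset N) (a : Fin ∣ D ∣) → element D a ∈ D
element∈ (inside ∷ D) zero = here
element∈ (inside ∷ D) (suc a) = there (element∈ D a)
element∈ (outside ∷ D) a = there (element∈ D a)

element-injective : (D : Subset N) → Injective _≡_ _≡_ (element D)
element-injective (inside ∷ D) {zero} {zero} _ = refl
element-injective (inside ∷ D) {suc a} {suc b} e≡e = cong suc (element-injective D (FP.suc-injective e≡e))
element-injective (outside ∷ D) e≡e = element-injective D (FP.suc-injective e≡e)

injective⇒≤∣_∣ : (D : Subset N) {f : Fin M → Fin N} → Injective _≡_ _≡_ f → (∀ i → f i ∈ D) → M ≤ ∣ D ∣
injective⇒≤∣ D ∣ f-inj f∈D = FP.injective⇒≤ λ p≡p → f-inj (position-injective D (f∈D _) (f∈D _) p≡p)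

image : (Fin M → Fin N) → Subset N
image f = tabulate λ x → does (FP.any? λ i → x ≟ f i)

∈-image : (f : Fin M → Fin N) (i : Fin M) → f i ∈ image f
∈-image f i = VecP.lookup⇒[]= (f i) (image f)
  (trans (VecP.lookup∘tabulate _ (f i)) (dec-true (FP.any? λ i′ → f i ≟ f i′) (i , refl)))

image-∈ : (f : Fin M → Fin N) {x : Fin N} → x ∈ image f → Σ[ i ∈ Fin M ] x ≡ f i
image-∈ f {x} x∈ = yes⇒ (FP.any? λ i → x ≟ f i)
  (trans (sym (VecP.lookup∘tabulate _ x)) (VecP.[]=⇒lookup x∈))
  where
  yes⇒ : ∀ {A : Set} (a? : Dec A) → does a? ≡ true → A
  yes⇒ (yes a) _ = a

∣image∣≡ : (f : Fin M → Fin N) → Injective _≡_ _≡_ f → ∣ image f ∣ ≡ M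
∣image∣≡ f f-inj = NP.≤-antisym
  (injective⊆image⇒≤ (element (image f)) (element-injective (image f)) f
                      (λ a → image-∈ f (element∈ (image f) a)))
  (injective⇒≤∣ image f ∣ f-inj (∈-image f))

-- Edge counts

𝟙 : Bool → ℕ
𝟙 b = if b then 1 else 0

𝟙≡0⇒≡false : ∀ {b} → 𝟙 b ≡ 0 → b ≡ false
𝟙≡0⇒≡false {false} _ = refl

∑≡0⇒≡0 : (f : Fin N → ℕ) → ∑[ i < N ] f i ≡ 0 → ∀ i → f i ≡ 0
∑≡0⇒≡0 f ∑≡0 zero = NP.m+n≡0⇒m≡0 (f zero) ∑≡0
∑≡0⇒≡0 f ∑≡0 (suc i) = ∑≡0⇒≡0 (f ∘ suc) (NP.m+n≡0⇒n≡0 (f zero) ∑≡0) i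

sum-map-allFin : (f : Fin N → ℕ) → sum (List.map f (List.allFin N)) ≡ ∑[ i < N ] f i
sum-map-allFin f = trans (cong sum (ListP.map-tabulate id f)) (sum-tabulate f)
  where
  sum-tabulate : (f : Fin N → ℕ) → sum (List.tabulate f) ≡ ∑[ i < N ] f i
  sum-tabulate {zero} f = refl
  sum-tabulate {suc N} f = cong (f zero +_) (sum-tabulate (f ∘ suc))

edgeCount≡∑∑ : (A : Fin N → Fin N → Bool) →
               edgeCount A ≡ ∑[ i < N ] ∑[ j < N ] 𝟙 ((toℕ i <ᵇ toℕ j) ∧ A i j)
edgeCount≡∑∑ {N} A = trans (cong sum (ListP.map-cong (sum-map-allFin ∘ below) (List.allFin N)))
                            (sum-map-allFin λ i → ∑[ j < N ] below i j)
  where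
  below : Fin N → Fin N → ℕ
  below i j = 𝟙 ((toℕ i <ᵇ toℕ j) ∧ A i j)

arcCount : (Fin N → Fin N → Bool) → ℕ
arcCount {N} A = ∑[ i < N ] ∑[ j < N ] 𝟙 (A i j)

arcCount-cong : {A B : Fin N → Fin N → Bool} → (∀ x y → A x y ≡ B x y) → arcCount A ≡ arcCount B
arcCount-cong A≡B = sum-cong-≗ λ x → sum-cong-≗ λ y → cong 𝟙 (A≡B x y)

arcCount-permute : (π : Permutation M N) (A : Fin N → Fin N → Bool) →
                   arcCount A ≡ arcCount (λ x y → A (π ⟨$⟩ʳ x) (π ⟨$⟩ʳ y))
arcCount-permute {N = N} π A =
  trans (∑-permute (λ x → ∑[ y < N ] 𝟙 (A x y)) π)
        (sum-cong-≗ λ x → ∑-permute (λ y → 𝟙 (A (π ⟨$⟩ʳ x) y)) π)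

module _ {A : Fin N → Fin N → Bool}
         (A-sym : ∀ x y → A x y ≡ A y x) (A-irrefl : ∀ x → A x x ≡ false) where

  arc-split : ∀ i j → 𝟙 ((toℕ i <ᵇ toℕ j) ∧ A i j) + 𝟙 ((toℕ j <ᵇ toℕ i) ∧ A j i) ≡ 𝟙 (A i j)
  arc-split i j with toℕ i <ᵇ toℕ j in i<ᵇj | toℕ j <ᵇ toℕ i in j<ᵇi
  ... | true  | true  = ⊥-elim (NP.<-asym (true⇒< (toℕ i) (toℕ j) i<ᵇj) (true⇒< (toℕ j) (toℕ i) j<ᵇi))
    where
    true⇒< : ∀ m n → (m <ᵇ n) ≡ true → m < n
    true⇒< m n p = NP.<ᵇ⇒< m n (subst T (sym p) tt)
  ... | true  | false = NP.+-identityʳ _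
  ... | false | true  = cong 𝟙 (A-sym j i)
  ... | false | false = cong 𝟙 (sym (subst (λ y → A i y ≡ false) (FP.toℕ-injective i≡j) (A-irrefl i)))
    where
    false⇒≮ : ∀ m n → (m <ᵇ n) ≡ false → ¬ m < n
    false⇒≮ m n p m<n = subst T p (NP.<⇒<ᵇ m<n)
    i≡j : toℕ i ≡ toℕ j
    i≡j = NP.≤-antisym (NP.≮⇒≥ (false⇒≮ (toℕ j) (toℕ i) j<ᵇi))
                       (NP.≮⇒≥ (false⇒≮ (toℕ i) (toℕ j) i<ᵇj))

  edgeCount-doubled : edgeCount A + edgeCount A ≡ arcCount A
  edgeCount-doubled = begin
    edgeCount A + edgeCount A
      ≡⟨ cong₂ _+_ (edgeCount≡∑∑ A) (trans (edgeCount≡∑∑ A) (∑-comm below)) ⟩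
    ∑[ i < N ] ∑[ j < N ] below i j + ∑[ i < N ] ∑[ j < N ] below j i
      ≡⟨ sym (∑-distrib-+ (λ i → ∑[ j < N ] below i j) (λ i → ∑[ j < N ] below j i)) ⟩
    ∑[ i < N ] (∑[ j < N ] below i j + ∑[ j < N ] below j i)
      ≡⟨ sum-cong-≗ (λ i → sym (∑-distrib-+ (below i) (λ j → below j i))) ⟩
    ∑[ i < N ] ∑[ j < N ] (below i j + below j i)
      ≡⟨ sum-cong-≗ (λ i → sum-cong-≗ (arc-split i)) ⟩
    arcCount A ∎
    where
    open ≡-Reasoning
    below : Fin N → Fin N → ℕ
    below i j = 𝟙 ((toℕ i <ᵇ toℕ j) ∧ A i j)

  edgeCount≡0⇒≡false : edgeCount A ≡ 0 → ∀ x y → A x y ≡ false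
  edgeCount≡0⇒≡false none x y = 𝟙≡0⇒≡false (∑≡0⇒≡0 _ (∑≡0⇒≡0 _ noArcs x) y)
    where
    noArcs : arcCount A ≡ 0
    noArcs = trans (sym edgeCount-doubled) (cong₂ _+_ none none)

+-double-injective : ∀ {m n} → m + m ≡ n + n → m ≡ n
+-double-injective {m} {n} m+m≡n+n with NP.<-cmp m n
... | tri< m<n _ _ = ⊥-elim (NP.<-irrefl m+m≡n+n (NP.+-mono-< m<n m<n))
... | tri≈ _ m≡n _ = m≡n
... | tri> _ _ n<m = ⊥-elim (NP.<-irrefl (sym m+m≡n+n) (NP.+-mono-< n<m n<m))

-- Isolating sets

Outside : (G : Graph) → Subset (n G) → Fin (n G) → Set
Outside G D x = ¬ InClosedNbhd G D x

inClosedNbhd? : (G : Graph) (D : Subset (n G)) (x : Fin (n G)) → Dec (InClosedNbhd G D x)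
inClosedNbhd? G D x = x ∈? D ⊎-dec FP.any? λ d → d ∈? D ×-dec adj G x d Bool.≟ true

outside-⁅⁆ : (G : Graph) {u x : Fin (n G)} → Outside G ⁅ u ⁆ x → x ≢ u × adj G x u ≡ false
outside-⁅⁆ G {u} out =
  (λ { refl → out (inj₁ (x∈⁅x⁆ u)) }) , ¬-not λ xu → out (inj₂ (u , x∈⁅x⁆ u , xu))

record Path₄ (A : Fin N → Fin N → Bool) (P : Fin N → Set) : Set where
  field
    vertex    : Fin 4 → Fin N
    injective : Injective _≡_ _≡_ vertex
    adjacent  : ∀ (a : Fin 3) → A (vertex (inject₁ a)) (vertex (suc a)) ≡ true
    satisfies : ∀ a → P (vertex a)

longCycle⇒path₄ : {A : Fin N → Fin N → Bool} {P : Fin N → Set} → 4 ≤ k → CycleIn A P k → Path₄ A P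
longCycle⇒path₄ {k = suc (suc (suc (suc k)))} (s≤s (s≤s (s≤s (s≤s z≤n)))) (f , f-inj , f-adj , f-P) =
  record
  { vertex    = λ a → f (a ↑ˡ k)
  ; injective = λ f≡f → FP.↑ˡ-injective k _ _ (f-inj f≡f)
  ; adjacent  = λ { zero → f-adj zero
                  ; (suc zero) → f-adj (suc zero)
                  ; (suc (suc zero)) → f-adj (suc (suc zero)) }
  ; satisfies = λ a → f-P (a ↑ˡ k)
  }

isolating-if-outside-covered : (G : Graph) (D : Subset (n G)) (o : Fin k → Fin (n G)) → k < 4 →
                               (∀ x → Outside G D x → Σ[ t ∈ Fin k ] x ≡ o t) → IsC'Isolating G D
isolating-if-outside-covered G D o k<4 covered (_ , 4≤l , cycle) =
  NP.<⇒≱ k<4 (injective⊆image⇒≤ vertex injective o λ a → covered (vertex a) (satisfies a))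
  where open Path₄ (longCycle⇒path₄ {A = adj G} {P = Outside G D} 4≤l cycle)

LongCycle : Graph → Set
LongCycle G = Σ[ k ∈ ℕ ] 4 ≤ k × CycleIn (adj G) (λ _ → ⊤) k

isolating⇒nonempty : (G : Graph) {D : Subset (n G)} → LongCycle G → IsC'Isolating G D → Nonempty D
isolating⇒nonempty G {D} (k , 4≤k , f , f-inj , f-adj , _) isolating with nonempty? D
... | yes nonempty = nonempty
... | no empty = ⊥-elim (isolating (k , 4≤k , f , f-inj , f-adj , λ _ →
        λ { (inj₁ x∈D) → empty (_ , x∈D) ; (inj₂ (d , d∈D , _)) → empty (d , d∈D) }))

AtMostNonNeighbours : Graph → ℕ → Set
AtMostNonNeighbours G k = Σ[ o ∈ (Fin (n G) → Fin k → Fin (n G)) ]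
  ∀ u x → x ≢ u → adj G x u ≡ false → Σ[ t ∈ Fin k ] x ≡ o u t

module _ (G : Graph) (k<4 : k < 4) (nonNeighbours : AtMostNonNeighbours G k) where

  ⁅⁆-isolating : ∀ u → IsC'Isolating G ⁅ u ⁆
  ⁅⁆-isolating u = isolating-if-outside-covered G ⁅ u ⁆ (proj₁ nonNeighbours u) k<4
    λ x out → let x≢u , xu = outside-⁅⁆ G out in proj₂ nonNeighbours u x x≢u xu

  ι≡1 : LongCycle G → ι-C'≡ G 1
  ι≡1 cycle@(suc _ , _ , f , _) =
    (⁅ f zero ⁆ , ⁅⁆-isolating (f zero) , ∣⁅x⁆∣≡1 (f zero)) , λ D isolating →
      let x , x∈D = isolating⇒nonempty G cycle isolating
      in NP.≤-trans (s≤s z≤n) (x∈p⇒∣p-x∣<∣p∣ x∈D)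

-- Isomorphism invariance

module _ {G H : Graph} (G≅H : G ≅ H) where
  open _≅_ G≅H

  to-injective : Injective _≡_ _≡_ to
  to-injective {x} {y} to≡to = trans (sym (from-to x)) (trans (cong from to≡to) (from-to y))

  ∣E∣-≅ : ∣E∣ G ≡ ∣E∣ H
  ∣E∣-≅ = +-double-injective (begin
    ∣E∣ G + ∣E∣ G
      ≡⟨ edgeCount-doubled (adj-sym G) (adj-irrefl G) ⟩
    arcCount (adj G)
      ≡⟨ arcCount-cong (λ x y → sym (adj-pres x y)) ⟩
    arcCount (λ x y → adj H (to x) (to y))
      ≡⟨ arcCount-permute (permutation to from to-from from-to) (adj H) ⟨
    arcCount (adj H)
      ≡⟨ edgeCount-doubled (adj-sym H) (adj-irrefl H) ⟨
    ∣E∣ H + ∣E∣ H ∎)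
    where open ≡-Reasoning

  LongCycle-≅ : LongCycle H → LongCycle G
  LongCycle-≅ (k , 4≤k , f , f-inj , f-adj , _) =
    k , 4≤k , from ∘ f ,
    (λ from≡from → f-inj (trans (sym (to-from _)) (trans (cong to from≡from) (to-from _)))) ,
    (λ i → trans (sym (adj-pres _ _)) (trans (cong₂ (adj H) (to-from _) (to-from _)) (f-adj i))) ,
    λ _ → tt

  AtMostNonNeighbours-≅ : AtMostNonNeighbours H k → AtMostNonNeighbours G k
  AtMostNonNeighbours-≅ (o , covered) =
    (λ u t → from (o (to u) t)) , λ u x x≢u xu →
      let t , tox≡ = covered (to u) (to x) (x≢u ∘ to-injective) (trans (adj-pres x u) xu)
      in t , trans (sym (from-to x)) (cong from tox≡)

-- The diamond and the 5-cycle

-- in C₄′ and C₅ every non-neighbour of u lies two or three steps after u along the cycle 0, 1, 2, …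
far : Fin N → Fin 2 → Fin N
far u zero = next (next u)
far u (suc zero) = next (next (next u))

nonNeighboursAmong? : (G : Graph) (o : Fin (n G) → Fin k → Fin (n G)) →
                      Dec (∀ u x → x ≢ u → adj G x u ≡ false → Σ[ t ∈ Fin k ] x ≡ o u t)
nonNeighboursAmong? G o = FP.all? λ u → FP.all? λ x →
  ¬? (x ≟ u) →-dec (adj G x u Bool.≟ false) →-dec FP.any? λ t → x ≟ o u t

hamiltonian? : (G : Graph) → Dec (∀ x → adj G x (next x) ≡ true)
hamiltonian? G = FP.all? λ x → adj G x (next x) Bool.≟ true

hamiltonian⇒LongCycle : (G : Graph) → 4 ≤ n G → (∀ x → adj G x (next x) ≡ true) → LongCycle G
hamiltonian⇒LongCycle G 4≤n hamiltonian = n G , 4≤n , id , id , hamiltonian , λ _ → tt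

Diamond-nonNeighbours : AtMostNonNeighbours Diamond 2
Diamond-nonNeighbours = far , toWitness {a? = nonNeighboursAmong? Diamond far} tt

C5-nonNeighbours : AtMostNonNeighbours C5 2
C5-nonNeighbours = far , toWitness {a? = nonNeighboursAmong? C5 far} tt

Diamond-longCycle : LongCycle Diamond
Diamond-longCycle = hamiltonian⇒LongCycle Diamond NP.≤-refl (toWitness {a? = hamiltonian? Diamond} tt)

C5-longCycle : LongCycle C5
C5-longCycle = hamiltonian⇒LongCycle C5 (NP.n≤1+n 4) (toWitness {a? = hamiltonian? C5} tt)

ι≡1-via-≅ : {G H : Graph} → G ≅ H → AtMostNonNeighbours H 2 → LongCycle H → ∣E∣ H ≡ 5 →
             ι-C'≡ G 1 × (∣E∣ G + 1 ≡ 6 * 1) × (∀ v → IsC'Isolating G ⁅ v ⁆)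
ι≡1-via-≅ {G} G≅H nonNeighbours cycle edges =
  ι≡1 G k<4 nonNeighboursG (LongCycle-≅ G≅H cycle) ,
  cong (_+ 1) (trans (∣E∣-≅ G≅H) edges) ,
  ⁅⁆-isolating G k<4 nonNeighboursG
  where
  k<4 : 2 < 4
  k<4 = NP.n≤1+n 3
  nonNeighboursG : AtMostNonNeighbours G 2
  nonNeighboursG = AtMostNonNeighbours-≅ G≅H nonNeighbours

-- Pure special graphs

Reach-edgeless : {A : Fin N → Fin N → Bool} → (∀ x y → A x y ≢ true) → ∀ {x y} → Reach A x y → x ≡ y
Reach-edgeless noEdge here = refl
Reach-edgeless noEdge (step xy _) = ⊥-elim (noEdge _ _ xy)

C₄-antipode : ∀ (j l : Fin 4) → l ≢ j → l ≢ next j → next l ≢ j → l ≡ next (next j)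
C₄-antipode = toWitness {a? = FP.all? λ j → FP.all? λ l →
  ¬? (l ≟ j) →-dec ¬? (l ≟ next j) →-dec ¬? (next l ≟ j) →-dec l ≟ next (next j)} tt

module PureSpecial {m : ℕ} {G : Graph} (S : Special m G) (pure : IsPure S) where
  open Special S renaming (T to tree)

  no-remainder-edge : ∀ x y → Radj x y ≢ true
  no-remainder-edge x y xy =
    contradiction (trans (sym xy) (edgeCount≡0⇒≡false Radj-sym Radj-irrefl pure x y)) λ ()

  m+1≡6q : m + 1 ≡ 6 * q
  m+1≡6q = begin
    m + 1      ≡⟨ split ⟩
    6 * q + r  ≡⟨ cong (6 * q +_) (trans (sym R-edges) pure) ⟩
    6 * q + 0  ≡⟨ NP.+-identityʳ (6 * q) ⟩
    6 * q      ∎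
    where open ≡-Reasoning

  InConstituent : Fin (n G) → Fin q → Set
  InConstituent x i = x ≡ v i ⊎ Σ[ j ∈ Fin 4 ] x ≡ c i j

  inConstituent-unique : ∀ {x i i′} → InConstituent x i → InConstituent x i′ → i ≡ i′
  inConstituent-unique (inj₁ x≡vi) (inj₁ x≡vi′) = v-inj (trans (sym x≡vi) x≡vi′)
  inConstituent-unique {i = i} {i′} (inj₁ x≡vi) (inj₂ (j , x≡c)) =
    ⊥-elim (v≢c i i′ j (trans (sym x≡vi) x≡c))
  inConstituent-unique {i = i} {i′} (inj₂ (j , x≡c)) (inj₁ x≡vi′) =
    ⊥-elim (v≢c i′ i j (trans (sym x≡vi′) x≡c))
  inConstituent-unique {i = i} {i′} (inj₂ (j , x≡c)) (inj₂ (j′ , x≡c′)) =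
    proj₁ (c-inj i j i′ j′ (trans (sym x≡c) x≡c′))

  adj-pendant : ∀ i → adj G (c i (w i)) (v i) ≡ true
  adj-pendant i = edges← _ _ (inj₂ (inj₂ (inj₂ (inj₁ (i , refl , refl)))))

  adj-cycle : ∀ i j → adj G (c i j) (c i (next j)) ≡ true
  adj-cycle i j = edges← _ _ (inj₁ (inj₂ (inj₁ (i , j , refl , refl))))

  adj-cycle⁻ : ∀ i j → adj G (c i (next j)) (c i j) ≡ true
  adj-cycle⁻ i j = edges← _ _ (inj₂ (inj₂ (inj₁ (i , j , refl , refl))))

  NoOutsideTreeEdge : Subset (n G) → Set
  NoOutsideTreeEdge D = ∀ a b → tree a b ≡ true → Outside G D (v a) → Outside G D (v b) → ⊥

  module _ {D : Subset (n G)} (noTreeEdge : NoOutsideTreeEdge D) where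

    specialEdge-outside : ∀ {x y} → SpecialEdge v c w tree Radj x y → Outside G D x → Outside G D y →
                          Σ[ i ∈ Fin q ] InConstituent x i × InConstituent y i
    specialEdge-outside (inj₁ (a , b , refl , refl , ab)) out-a out-b = ⊥-elim (noTreeEdge a b ab out-a out-b)
    specialEdge-outside (inj₂ (inj₁ (i , j , x≡ , y≡))) _ _ = i , inj₂ (j , x≡) , inj₂ (next j , y≡)
    specialEdge-outside (inj₂ (inj₂ (inj₁ (i , x≡ , y≡)))) _ _ = i , inj₁ x≡ , inj₂ (w i , y≡)
    specialEdge-outside (inj₂ (inj₂ (inj₂ xy))) _ _ = ⊥-elim (no-remainder-edge _ _ xy)

    outsideEdge⇒sameConstituent : ∀ {x y} → adj G x y ≡ true → Outside G D x → Outside G D y →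
                                  Σ[ i ∈ Fin q ] InConstituent x i × InConstituent y i
    outsideEdge⇒sameConstituent {x} {y} xy out-x out-y with edges→ x y xy
    ... | inj₁ xy-edge = specialEdge-outside xy-edge out-x out-y
    ... | inj₂ yx-edge = map₂ swap (specialEdge-outside yx-edge out-y out-x)

  FewOutside : Subset (n G) → Fin q → Set
  FewOutside D i = Σ[ o ∈ (Fin 3 → Fin (n G)) ]
    ∀ x → InConstituent x i → Outside G D x → Σ[ t ∈ Fin 3 ] x ≡ o t

  isolating-if-fewOutside : ∀ {D} → NoOutsideTreeEdge D → (∀ i → FewOutside D i) → IsC'Isolating G D
  isolating-if-fewOutside {D} noTreeEdge few (_ , 4≤k , cycle) =
    NP.<⇒≱ (NP.n<1+n 3) (injective⊆image⇒≤ vertex injective (proj₁ (few i))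
      λ a → proj₂ (few i) (vertex a) (member a) (satisfies a))
    where
    open Path₄ (longCycle⇒path₄ {A = adj G} {P = Outside G D} 4≤k cycle)
    edge : ∀ a → Σ[ i ∈ Fin q ] InConstituent (vertex (inject₁ a)) i × InConstituent (vertex (suc a)) i
    edge a = outsideEdge⇒sameConstituent noTreeEdge (adjacent a) (satisfies _) (satisfies _)
    i : Fin q
    i = proj₁ (edge zero)
    extend : ∀ a → InConstituent (vertex (inject₁ a)) i → InConstituent (vertex (suc a)) i
    extend a tail∈i = let _ , tail∈ , head∈ = edge a in
      subst (InConstituent _) (inConstituent-unique tail∈ tail∈i) head∈
    member₀ : InConstituent (vertex zero) i
    member₀ = proj₁ (proj₂ (edge zero))
    member₁ : InConstituent (vertex (suc zero)) i
    member₁ = extend zero member₀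
    member₂ : InConstituent (vertex (suc (suc zero))) i
    member₂ = extend (suc zero) member₁
    member : ∀ a → InConstituent (vertex a) i
    member zero = member₀
    member (suc zero) = member₁
    member (suc (suc zero)) = member₂
    member (suc (suc (suc zero))) = extend (suc (suc zero)) member₂

  connection∈⇒fewOutside : ∀ {D i} → v i ∈ D → FewOutside D i
  connection∈⇒fewOutside {D} {i} vi∈D = c i ∘ punchIn (w i) , covered
    where
    covered : ∀ x → InConstituent x i → Outside G D x → Σ[ t ∈ Fin 3 ] x ≡ c i (punchIn (w i) t)
    covered x (inj₁ refl) out = ⊥-elim (out (inj₁ vi∈D))
    covered x (inj₂ (l , refl)) out with w i ≟ l
    ... | yes refl = ⊥-elim (out (inj₂ (v i , vi∈D , adj-pendant i)))
    ... | no wi≢l = punchOut wi≢l , cong (c i) (sym (FP.punchIn-punchOut wi≢l))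

  cycleVertex∈⇒fewOutside : ∀ {D i j} → c i j ∈ D → FewOutside D i
  cycleVertex∈⇒fewOutside {D} {i} {j} cij∈D = o , covered
    where
    o : Fin 3 → Fin (n G)
    o zero = v i
    o (suc _) = c i (next (next j))
    covered : ∀ x → InConstituent x i → Outside G D x → Σ[ t ∈ Fin 3 ] x ≡ o t
    covered x (inj₁ refl) _ = zero , refl
    covered x (inj₂ (l , refl)) out = suc zero , cong (c i) (C₄-antipode j l l≢j l≢next-j next-l≢j)
      where
      l≢j : l ≢ j
      l≢j refl = out (inj₁ cij∈D)
      l≢next-j : l ≢ next j
      l≢next-j refl = out (inj₂ (c i j , cij∈D , adj-cycle⁻ i j))
      next-l≢j : next l ≢ j
      next-l≢j refl = out (inj₂ (c i (next l) , cij∈D , adj-cycle i l))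

  D₀ : Subset (n G)
  D₀ = image v

  D₀-isolating : IsC'Isolating G D₀
  D₀-isolating = isolating-if-fewOutside (λ a _ _ out-a _ → out-a (inj₁ (∈-image v a)))
                                         (λ i → connection∈⇒fewOutside (∈-image v i))

  module Exchange (i : Fin q) (j : Fin 4) where

    u : Fin q → Fin (n G)
    u = updateAt v i (const (c i j))

    u-i : u i ≡ c i j
    u-i = updateAt-updates i v

    u-k : ∀ {k} → k ≢ i → u k ≡ v k
    u-k {k} k≢i = updateAt-minimal k i v k≢i

    u-injective : Injective _≡_ _≡_ u
    u-injective {a} {b} ua≡ub with a ≟ i | b ≟ i
    ... | yes refl | yes refl = refl
    ... | yes refl | no b≢i = ⊥-elim (v≢c b i j (trans (sym (u-k b≢i)) (trans (sym ua≡ub) u-i)))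
    ... | no a≢i | yes refl = ⊥-elim (v≢c a i j (trans (sym (u-k a≢i)) (trans ua≡ub u-i)))
    ... | no a≢i | no b≢i = v-inj (trans (sym (u-k a≢i)) (trans ua≡ub (u-k b≢i)))

    D₁ : Subset (n G)
    D₁ = image u

    cij∈D₁ : c i j ∈ D₁
    cij∈D₁ = subst (_∈ D₁) u-i (∈-image u i)

    vk∈D₁ : ∀ {k} → k ≢ i → v k ∈ D₁
    vk∈D₁ {k} k≢i = subst (_∈ D₁) (u-k k≢i) (∈-image u k)

    D₁-isolating : IsC'Isolating G D₁
    D₁-isolating = isolating-if-fewOutside noTreeEdge few
      where
      noTreeEdge : NoOutsideTreeEdge D₁
      noTreeEdge a b ab out-a out-b with a ≟ i | b ≟ i
      ... | no a≢i | _ = out-a (inj₁ (vk∈D₁ a≢i))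
      ... | yes _ | no b≢i = out-b (inj₁ (vk∈D₁ b≢i))
      ... | yes refl | yes refl = contradiction (trans (sym ab) (tree-irrefl a)) λ ()
        where
        tree-irrefl : ∀ a → tree a a ≡ false
        tree-irrefl = proj₁ (proj₂ T-tree)
      few : ∀ k → FewOutside D₁ k
      few k with k ≟ i
      ... | yes refl = cycleVertex∈⇒fewOutside cij∈D₁
      ... | no k≢i = connection∈⇒fewOutside (vk∈D₁ k≢i)

  module _ {i : Fin q} {j : Fin 4} {d : Fin (n G)} where

    from-cycleVertex : SpecialEdge v c w tree Radj (c i j) d → InConstituent d i
    from-cycleVertex (inj₁ (a , _ , cij≡va , _)) = ⊥-elim (v≢c a i j (sym cij≡va))
    from-cycleVertex (inj₂ (inj₁ (i′ , j′ , cij≡ , d≡))) with c-inj i j i′ j′ cij≡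
    ... | refl , _ = inj₂ (next j′ , d≡)
    from-cycleVertex (inj₂ (inj₂ (inj₁ (i′ , cij≡vi′ , _)))) = ⊥-elim (v≢c i′ i j (sym cij≡vi′))
    from-cycleVertex (inj₂ (inj₂ (inj₂ remainderEdge))) = ⊥-elim (no-remainder-edge _ _ remainderEdge)

    to-cycleVertex : SpecialEdge v c w tree Radj d (c i j) → InConstituent d i
    to-cycleVertex (inj₁ (_ , b , _ , cij≡vb , _)) = ⊥-elim (v≢c b i j (sym cij≡vb))
    to-cycleVertex (inj₂ (inj₁ (i′ , j′ , d≡ , cij≡))) with c-inj i j i′ (next j′) cij≡
    ... | refl , _ = inj₂ (j′ , d≡)
    to-cycleVertex (inj₂ (inj₂ (inj₁ (i′ , d≡ , cij≡)))) with c-inj i j i′ (w i′) cij≡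
    ... | refl , _ = inj₁ d≡
    to-cycleVertex (inj₂ (inj₂ (inj₂ remainderEdge))) = ⊥-elim (no-remainder-edge _ _ remainderEdge)

    cycleVertex-neighbour : adj G (c i j) d ≡ true → InConstituent d i
    cycleVertex-neighbour cij-d with edges→ (c i j) d cij-d
    ... | inj₁ edge = from-cycleVertex edge
    ... | inj₂ edge = to-cycleVertex edge

  isolating⇒meetsConstituent : ∀ {D} → IsC'Isolating G D →
                               ∀ i → Σ[ d ∈ Fin (n G) ] d ∈ D × InConstituent d i
  isolating⇒meetsConstituent {D} isolating i with FP.any? (λ j → inClosedNbhd? G D (c i j))
  ... | yes (j , inj₁ cij∈D) = c i j , cij∈D , inj₂ (j , refl)
  ... | yes (j , inj₂ (d , d∈D , cij-d)) = d , d∈D , cycleVertex-neighbour cij-d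
  ... | no untouched = ⊥-elim (isolating (4 , NP.≤-refl , c i ,
          (λ cij≡cij′ → proj₂ (c-inj i _ i _ cij≡cij′)) , adj-cycle i , λ j inN → untouched (j , inN)))

  q≤∣isolating∣ : ∀ {D} → IsC'Isolating G D → q ≤ ∣ D ∣
  q≤∣isolating∣ {D} isolating =
    injective⇒≤∣ D ∣ {f = proj₁ ∘ meets} representative-injective (proj₁ ∘ proj₂ ∘ meets)
    where
    meets : ∀ i → Σ[ d ∈ Fin (n G) ] d ∈ D × InConstituent d i
    meets = isolating⇒meetsConstituent isolating
    representative-injective : Injective _≡_ _≡_ (proj₁ ∘ meets)
    representative-injective {a} {b} da≡db = inConstituent-unique (proj₂ (proj₂ (meets a)))
      (subst (λ d → InConstituent d b) (sym da≡db) (proj₂ (proj₂ (meets b))))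

  ι≡q : ι-C'≡ G q
  ι≡q = (D₀ , D₀-isolating , ∣image∣≡ v v-inj) , λ D → q≤∣isolating∣

  remainder-vertex : ∀ {x} → x ∈ R → x ≡ v last
  remainder-vertex {x} x∈R = Reach-edgeless no-remainder-edge (R-connected x (v last) x∈R vlast∈R)

  minimumIsolating∋ : ∀ x → Σ[ D ∈ Subset (n G) ] IsC'Isolating G D × x ∈ D × ∣ D ∣ ≡ q
  minimumIsolating∋ x with cover x
  ... | inj₁ (i , refl) = D₀ , D₀-isolating , ∈-image v i , ∣image∣≡ v v-inj
  ... | inj₂ (inj₁ (i , j , refl)) = D₁ , D₁-isolating , cij∈D₁ , ∣image∣≡ u u-injective
    where open Exchange i j
  ... | inj₂ (inj₂ x∈R) =
    D₀ , D₀-isolating , subst (_∈ D₀) (sym (remainder-vertex x∈R)) (∈-image v last) , ∣image∣≡ v v-inj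

proposition2p7 :
    (∀ (m q : ℕ) (G : Graph) (S : Special m G) → Special.q S ≡ q → IsPure S →
       (m + 1 ≡ 6 * q)
       × ι-C'≡ G q
       × (∀ (v : Fin (n G)) →
            Σ[ D ∈ Subset (n G) ] IsC'Isolating G D × v ∈ D × ∣ D ∣ ≡ q))
    × (∀ (G : Graph) → (G ≅ Diamond ⊎ G ≅ C5) →
         ι-C'≡ G 1
         × (∣E∣ G + 1 ≡ 6 * 1)
         × (∀ (v : Fin (n G)) → IsC'Isolating G ⁅ v ⁆))
proposition2p7 =
  (λ { m q G S refl pure → let open PureSpecial S pure in m+1≡6q , ι≡q , minimumIsolating∋ }) ,
  λ { G (inj₁ G≅Diamond) → ι≡1-via-≅ G≅Diamond Diamond-nonNeighbours Diamond-longCycle refl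
    ; G (inj₂ G≅C5) → ι≡1-via-≅ G≅C5 C5-nonNeighbours C5-longCycle refl }
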